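{- Let $q$ be a prime power and let $q+1=p_1^{k_1}\cdots p_t^{k_t}$ be the prime factorization of $q+1$, where, when $q$ is odd, $p_1=2$. Then: (a) there are $2^t$ integers $m$ with $0\le m\le q$ such that $m^2-m\equiv0\pmod{q+1}$; (b) if $q$ is even, there are $p_1^{\lfloor k_1/2\rfloor}\cdots p_t^{\lfloor k_t/2\rfloor}$ integers $m$ with $0\le m\le q$ such that $m^2\equiv0\pmod{q+1}$; (c) if $q\equiv-1\pmod 4$, there are $p_1^{\lfloor k_1/2\rfloor}\cdots p_t^{\lfloor k_t/2\rfloor}$ integers $m$ with $0\le m\le q$ such that $m^2+\frac{q+1}{2}m\equiv0\pmod{q+1}$; (d) if $q\equiv1\pmod 4$, there are $2\cdot p_2^{\lfloor k_2/2\rfloor}\cdots p_t^{\lfloor k_t/2\rfloor}$ integers $m$ with $0\le m\le q$ such that $m^2+\frac{q+1}{2}m\equiv0\pmod{q+1}$. -}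

module Defs where

open import Data.Nat using (ℕ; suc; _+_; _*_; _^_; _≤_; _/_; _%_; NonZero)
open import Data.Nat.Primality using (Prime)
open import Data.Product using (_×_; _,_; proj₁; ∃-syntax)
open import Data.List using (List; map; length; filter; upTo)
open import Data.Nat.ListAction using (product)
open import Data.List.Relation.Unary.All using (All)
open import Data.List.Relation.Unary.Unique.Propositional using (Unique)
open import Relation.Binary.PropositionalEquality using (_≡_)
open import Relation.Unary using (Pred; Decidable)
open import Level using (0ℓ)

IsPrimePower : ℕ → Set
IsPrimePower q = ∃[ p ] ∃[ e ] (Prime p × 1 ≤ e × q ≡ p ^ e)

IsPrimeFactorization : ℕ → List (ℕ × ℕ) → Set
IsPrimeFactorization n fs =
  All (λ pk → Prime (proj₁ pk) × 1 ≤ Data.Product.proj₂ pk) fs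
  × Unique (map proj₁ fs)
  × product (map (λ pk → proj₁ pk ^ Data.Product.proj₂ pk) fs) ≡ n

halfPowProduct : List (ℕ × ℕ) → ℕ
halfPowProduct fs = product (map (λ pk → proj₁ pk ^ (Data.Product.proj₂ pk / 2)) fs)

ModEq : (n : ℕ) → .{{NonZero n}} → ℕ → ℕ → Set
ModEq n a b = a % n ≡ b % n

countBelow : (n : ℕ) (P : Pred ℕ 0ℓ) → Decidable P → ℕ
countBelow n P P? = length (filter P? (upTo n))

{-# OPTIONS --safe #-}
module Submission where

open import Defs
open import Data.Nat
open import Data.Nat.Properties
open import Data.Nat.DivMod
open import Data.Nat.Divisibility
open import Data.Nat.Primality
open import Data.Nat.Tactic.RingSolver using (solve-∀)
open import Data.Nat.ListAction using (product)
open import Data.Product using (_×_; _,_; proj₁; proj₂; ∃-syntax)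
open import Data.Sum using (inj₁; inj₂; [_,_]′)
open import Data.List using (List; []; _∷_; _++_; map; length; filter; upTo)
open import Data.List.Properties using (upTo-∷ʳ; filter-++; length-++)
open import Data.List.Relation.Unary.All using (All; []; _∷_)
import Data.List.Relation.Unary.All.Properties as All
open import Data.List.Relation.Unary.AllPairs using (_∷_)
open import Function using (id; _∘_; _⇔_; mk⇔; Equivalence)
import Function.Properties.Equivalence as ⇔
open import Function.Related.Propositional using (module EquationalReasoning; equivalence)
open import Relation.Nullary using (Dec; yes; no; ¬_; contradiction)
open import Relation.Nullary.Decidable using (_×-dec_)
open import Relation.Unary using (Pred; Decidable)
open import Relation.Binary.PropositionalEquality
open import Level using (0ℓ)

-- By the Chinese remainder theorem, the number of solutions of a polynomial congruence
-- modulo N = p₁^k₁ ⋯ p_t^k_t is the product of the numbers of solutions modulo the pᵢ^kᵢ.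
-- Modulo a prime power the only idempotents are 0 and 1. If p^⌈k/2⌉ divides c, then
-- p^k ∣ m² + cm exactly when p^⌈k/2⌉ ∣ m, which happens for p^⌊k/2⌋ residues m; this
-- covers m² (c = 0) and, when 4 ∣ q + 1, c = (q + 1)/2. When q + 1 ≡ 2 (mod 4), c is odd
-- and the factor 2 instead contributes both residues 0 and 1.

𝟙 : ∀ {P : Set} → Dec P → ℕ
𝟙 (yes _) = 1
𝟙 (no _)  = 0

𝟙-yes : ∀ {P : Set} (P? : Dec P) → P → 𝟙 P? ≡ 1
𝟙-yes (yes _) _ = refl
𝟙-yes (no ¬p) p = contradiction p ¬p

𝟙-no : ∀ {P : Set} (P? : Dec P) → ¬ P → 𝟙 P? ≡ 0
𝟙-no (yes p) ¬p = contradiction p ¬p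
𝟙-no (no _)  _  = refl

𝟙-cong : ∀ {P Q : Set} (P? : Dec P) (Q? : Dec Q) → P ⇔ Q → 𝟙 P? ≡ 𝟙 Q?
𝟙-cong (yes p) Q? P⇔Q = sym (𝟙-yes Q? (Equivalence.to P⇔Q p))
𝟙-cong (no ¬p) Q? P⇔Q = sym (𝟙-no Q? (λ q → ¬p (Equivalence.from P⇔Q q)))

𝟙-× : ∀ {P Q : Set} (P? : Dec P) (Q? : Dec Q) → 𝟙 (P? ×-dec Q?) ≡ 𝟙 P? * 𝟙 Q?
𝟙-× (yes _) (yes _) = refl
𝟙-× (yes _) (no _)  = refl
𝟙-× (no _)  _       = refl

∑< : ℕ → (ℕ → ℕ) → ℕ
∑< zero    f = 0
∑< (suc n) f = ∑< n f + f n

syntax ∑< n (λ m → e) = ∑[ m < n ] e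

∑-cong : ∀ n {f g : ℕ → ℕ} → (∀ m → m < n → f m ≡ g m) → ∑< n f ≡ ∑< n g
∑-cong zero    f≗g = refl
∑-cong (suc n) f≗g = cong₂ _+_ (∑-cong n (λ m m<n → f≗g m (m<n⇒m<1+n m<n))) (f≗g n (n<1+n n))

∑-distrib-+ : ∀ n (f g : ℕ → ℕ) → ∑[ m < n ] (f m + g m) ≡ ∑< n f + ∑< n g
∑-distrib-+ zero    f g = refl
∑-distrib-+ (suc n) f g rewrite ∑-distrib-+ n f g = interchange (∑< n f) (∑< n g) (f n) (g n)
  where
  interchange : ∀ a b c d → (a + b) + (c + d) ≡ (a + c) + (b + d)
  interchange = solve-∀

∑-*ˡ : ∀ n c (f : ℕ → ℕ) → ∑[ m < n ] (c * f m) ≡ c * ∑< n f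
∑-*ˡ zero    c f = sym (*-zeroʳ c)
∑-*ˡ (suc n) c f rewrite ∑-*ˡ n c f = sym (*-distribˡ-+ c (∑< n f) (f n))

∑-*ʳ : ∀ n c (f : ℕ → ℕ) → ∑[ m < n ] (f m * c) ≡ ∑< n f * c
∑-*ʳ n c f = begin
  ∑[ m < n ] (f m * c)  ≡⟨ ∑-cong n (λ m _ → *-comm (f m) c) ⟩
  ∑[ m < n ] (c * f m)  ≡⟨ ∑-*ˡ n c f ⟩
  c * ∑< n f            ≡⟨ *-comm c (∑< n f) ⟩
  ∑< n f * c            ∎
  where open ≡-Reasoning

∑-const : ∀ n c → ∑[ _ < n ] c ≡ n * c
∑-const zero    c = refl
∑-const (suc n) c rewrite ∑-const n c = +-comm (n * c) c

∑-comm : ∀ a b (h : ℕ → ℕ → ℕ) → ∑[ i < a ] ∑[ j < b ] h i j ≡ ∑[ j < b ] ∑[ i < a ] h i j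
∑-comm zero    b h = sym (trans (∑-const b 0) (*-zeroʳ b))
∑-comm (suc a) b h rewrite ∑-comm a b h = sym (∑-distrib-+ b (λ j → ∑[ i < a ] h i j) (h a))

∑-split : ∀ a b (f : ℕ → ℕ) → ∑< (a + b) f ≡ ∑< a f + ∑[ j < b ] f (a + j)
∑-split a zero    f rewrite +-identityʳ a = sym (+-identityʳ (∑< a f))
∑-split a (suc b) f rewrite +-suc a b | ∑-split a b f = +-assoc (∑< a f) _ _

∑-≡0 : ∀ n {f : ℕ → ℕ} → (∀ m → m < n → f m ≡ 0) → ∑< n f ≡ 0
∑-≡0 n f≗0 = trans (∑-cong n f≗0) (trans (∑-const n 0) (*-zeroʳ n))

δ : ℕ → ℕ → ℕ
δ i j = 𝟙 (i ≟ j)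

∑-δ : ∀ n w (h : ℕ → ℕ) → w < n → ∑[ i < n ] (δ i w * h i) ≡ h w
∑-δ (suc n) w h w<1+n with n ≟ w
... | yes refl = begin
  ∑[ i < n ] (δ i n * h i) + (h n + 0)  ≡⟨ cong₂ _+_ off-diagonal (+-identityʳ (h n)) ⟩
  0 + h n                               ∎
  where
  open ≡-Reasoning
  off-diagonal : ∑[ i < n ] (δ i n * h i) ≡ 0
  off-diagonal = ∑-≡0 n (λ i i<n → cong (_* h i) (𝟙-no (i ≟ n) (<⇒≢ i<n)))
... | no n≢w = trans (+-identityʳ _) (∑-δ n w h (≤∧≢⇒< (≤-pred w<1+n) (≢-sym n≢w)))

∑-δ≡1 : ∀ n w → w < n → ∑[ i < n ] δ i w ≡ 1
∑-δ≡1 n w w<n = trans (∑-cong n (λ i _ → sym (*-identityʳ (δ i w)))) (∑-δ n w (λ _ → 1) w<n)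

∑-≤ : ∀ n b (f : ℕ → ℕ) → (∀ m → m < n → f m ≤ b) → ∑< n f ≤ n * b
∑-≤ zero    b f f≤b = z≤n
∑-≤ (suc n) b f f≤b = subst (∑< n f + f n ≤_) (+-comm (n * b) b)
  (+-mono-≤ (∑-≤ n b f (λ m m<n → f≤b m (m<n⇒m<1+n m<n))) (f≤b n (n<1+n n)))

∑-≤-tight : ∀ n b (f : ℕ → ℕ) → (∀ m → m < n → f m ≤ b) → ∑< n f ≡ n * b
          → ∀ m → m < n → f m ≡ b
∑-≤-tight (suc n) b f f≤b ∑≡ = tight
  where
  f≤b′ : ∀ m → m < n → f m ≤ b
  f≤b′ m m<n = f≤b m (m<n⇒m<1+n m<n)
  last≡b : f n ≡ b
  last≡b = ≤-antisym (f≤b n (n<1+n n)) (≮⇒≥ λ fn<b →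
    <⇒≢ (+-mono-≤-< (∑-≤ n b f f≤b′) fn<b) (trans ∑≡ (+-comm b (n * b))))
  init≡ : ∑< n f ≡ n * b
  init≡ = +-cancelʳ-≡ (f n) _ _ (trans ∑≡ (trans (+-comm b (n * b)) (cong (n * b +_) (sym last≡b))))
  tight : ∀ m → m < suc n → f m ≡ b
  tight m m<1+n with m≤n⇒m<n∨m≡n (≤-pred m<1+n)
  ... | inj₁ m<n  = ∑-≤-tight n b f f≤b′ init≡ m m<n
  ... | inj₂ refl = last≡b

∑-𝟙-unique≤1 : ∀ n {P : Pred ℕ 0ℓ} (P? : Decidable P)
             → (∀ {x y} → x < n → y < n → P x → P y → x ≡ y) → ∑[ m < n ] 𝟙 (P? m) ≤ 1
∑-𝟙-unique≤1 zero    P? unique = z≤n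
∑-𝟙-unique≤1 (suc n) P? unique with P? n
... | no _   = subst (_≤ 1) (sym (+-identityʳ _))
                 (∑-𝟙-unique≤1 n P? (λ x<n y<n → unique (m<n⇒m<1+n x<n) (m<n⇒m<1+n y<n)))
... | yes Pn = ≤-reflexive (cong (_+ 1) (∑-≡0 n λ m m<n → 𝟙-no (P? m) λ Pm →
                 <⇒≢ m<n (unique (m<n⇒m<1+n m<n) (n<1+n n) Pm Pn)))

countBelow≡∑𝟙 : ∀ n {P : Pred ℕ 0ℓ} (P? : Decidable P) → countBelow n P P? ≡ ∑[ m < n ] 𝟙 (P? m)
countBelow≡∑𝟙 zero    P? = refl
countBelow≡∑𝟙 (suc n) P? = begin
  length (filter P? (upTo (suc n)))                          ≡⟨ cong (length ∘ filter P?) (upTo-∷ʳ n) ⟨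
  length (filter P? (upTo n ++ n ∷ []))                      ≡⟨ cong length (filter-++ P? (upTo n) (n ∷ [])) ⟩
  length (filter P? (upTo n) ++ filter P? (n ∷ []))          ≡⟨ length-++ (filter P? (upTo n)) ⟩
  length (filter P? (upTo n)) + length (filter P? (n ∷ []))  ≡⟨ cong₂ _+_ (countBelow≡∑𝟙 n P?) (last n) ⟩
  ∑[ m < n ] 𝟙 (P? m) + 𝟙 (P? n)                             ∎
  where
  open ≡-Reasoning
  last : ∀ n → length (filter P? (n ∷ [])) ≡ 𝟙 (P? n)
  last n with P? n
  ... | yes _ = refl
  ... | no _  = refl

-- Instead of inverting m ↦ (m % d , m % e) we count: every residue pair is hit at most
-- once, and the d · e pairs receive N = d · e hits in total, so each is hit exactly once.
module _ (d e N : ℕ) .{{_ : NonZero d}} .{{_ : NonZero e}} (N≡d*e : N ≡ d * e)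
         (residues-injective : ∀ {m m′} → m < N → m′ < N → m % d ≡ m′ % d → m % e ≡ m′ % e → m ≡ m′)
         where

  private
    hits : ℕ → ℕ → ℕ
    hits i j = ∑[ m < N ] (δ i (m % d) * δ j (m % e))

    hits≤1 : ∀ i j → hits i j ≤ 1
    hits≤1 i j = subst (_≤ 1) (∑-cong N λ m _ → 𝟙-× (i ≟ m % d) (j ≟ m % e))
      (∑-𝟙-unique≤1 N (λ m → (i ≟ m % d) ×-dec (j ≟ m % e))
        λ { x<N y<N (i≡x , j≡x) (i≡y , j≡y) →
            residues-injective x<N y<N (trans (sym i≡x) i≡y) (trans (sym j≡x) j≡y) })

    residues-once : ∀ m → ∑[ i < d ] ∑[ j < e ] (δ i (m % d) * δ j (m % e)) ≡ 1
    residues-once m = begin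
      ∑[ i < d ] ∑[ j < e ] (δ i (m % d) * δ j (m % e))
        ≡⟨ ∑-cong d (λ i _ → ∑-*ˡ e (δ i (m % d)) (λ j → δ j (m % e))) ⟩
      ∑[ i < d ] (δ i (m % d) * ∑[ j < e ] δ j (m % e))
        ≡⟨ ∑-cong d (λ i _ → cong (δ i (m % d) *_) (∑-δ≡1 e (m % e) (m%n<n m e))) ⟩
      ∑[ i < d ] (δ i (m % d) * 1)
        ≡⟨ ∑-δ d (m % d) (λ _ → 1) (m%n<n m d) ⟩
      1 ∎
      where open ≡-Reasoning

    all-hits : ∑[ i < d ] ∑[ j < e ] hits i j ≡ d * e
    all-hits = begin
      ∑[ i < d ] ∑[ j < e ] ∑[ m < N ] (δ i (m % d) * δ j (m % e))  ≡⟨ ∑-cong d (λ i _ → ∑-comm e N _) ⟩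
      ∑[ i < d ] ∑[ m < N ] ∑[ j < e ] (δ i (m % d) * δ j (m % e))  ≡⟨ ∑-comm d N _ ⟩
      ∑[ m < N ] ∑[ i < d ] ∑[ j < e ] (δ i (m % d) * δ j (m % e))  ≡⟨ ∑-cong N (λ m _ → residues-once m) ⟩
      ∑[ m < N ] 1                                                  ≡⟨ trans (∑-const N 1) (*-identityʳ N) ⟩
      N                                                             ≡⟨ N≡d*e ⟩
      d * e                                                         ∎
      where open ≡-Reasoning

    row≤e : ∀ i → ∑[ j < e ] hits i j ≤ e
    row≤e i = subst (∑< e (hits i) ≤_) (*-identityʳ e) (∑-≤ e 1 (hits i) (λ j _ → hits≤1 i j))

    hits≡1 : ∀ {i j} → i < d → j < e → hits i j ≡ 1
    hits≡1 {i} {j} i<d j<e = ∑-≤-tight e 1 (hits i) (λ j _ → hits≤1 i j)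
      (trans (∑-≤-tight d e (λ i → ∑[ j < e ] hits i j) (λ i _ → row≤e i) all-hits i i<d)
             (sym (*-identityʳ e)))
      j j<e

  ∑-CRT : ∀ (a b : ℕ → ℕ) → ∑[ m < N ] (a (m % d) * b (m % e)) ≡ ∑< d a * ∑< e b
  ∑-CRT a b = begin
    ∑[ m < N ] (a (m % d) * b (m % e))
      ≡⟨ ∑-cong N (λ m _ → sym (expand m)) ⟩
    ∑[ m < N ] ∑[ i < d ] ∑[ j < e ] (a i * b j * (δ i (m % d) * δ j (m % e)))
      ≡⟨ sym (∑-comm d N _) ⟩
    ∑[ i < d ] ∑[ m < N ] ∑[ j < e ] (a i * b j * (δ i (m % d) * δ j (m % e)))
      ≡⟨ ∑-cong d (λ i _ → sym (∑-comm e N _)) ⟩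
    ∑[ i < d ] ∑[ j < e ] ∑[ m < N ] (a i * b j * (δ i (m % d) * δ j (m % e)))
      ≡⟨ ∑-cong d (λ i i<d → ∑-cong e (λ j j<e → trans (∑-*ˡ N (a i * b j) _)
           (trans (cong (a i * b j *_) (hits≡1 i<d j<e)) (*-identityʳ _)))) ⟩
    ∑[ i < d ] ∑[ j < e ] (a i * b j)
      ≡⟨ ∑-cong d (λ i _ → ∑-*ˡ e (a i) b) ⟩
    ∑[ i < d ] (a i * ∑< e b)
      ≡⟨ ∑-*ʳ d (∑< e b) a ⟩
    ∑< d a * ∑< e b ∎
    where
    open ≡-Reasoning
    expand : ∀ m → ∑[ i < d ] ∑[ j < e ] (a i * b j * (δ i (m % d) * δ j (m % e))) ≡ a (m % d) * b (m % e)
    expand m = begin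
      ∑[ i < d ] ∑[ j < e ] (a i * b j * (δ i x * δ j y))
        ≡⟨ ∑-cong d (λ i _ → ∑-cong e (λ j _ → regroup (a i) (b j) (δ i x) (δ j y))) ⟩
      ∑[ i < d ] ∑[ j < e ] (δ j y * (a i * δ i x * b j))
        ≡⟨ ∑-cong d (λ i _ → ∑-δ e y (λ j → a i * δ i x * b j) (m%n<n m e)) ⟩
      ∑[ i < d ] (a i * δ i x * b y)
        ≡⟨ ∑-cong d (λ i _ → regroup′ (a i) (δ i x) (b y)) ⟩
      ∑[ i < d ] (δ i x * (a i * b y))
        ≡⟨ ∑-δ d x (λ i → a i * b y) (m%n<n m d) ⟩
      a x * b y ∎
      where
      x = m % d
      y = m % e
      regroup : ∀ a b u v → a * b * (u * v) ≡ v * (a * u * b)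
      regroup = solve-∀
      regroup′ : ∀ a u b → a * u * b ≡ u * (a * b)
      regroup′ = solve-∀

%≡%⇒∣∸ : ∀ N .{{_ : NonZero N}} {u v} → v ≤ u → u % N ≡ v % N → N ∣ u ∸ v
%≡%⇒∣∸ N {u} {v} v≤u u≡v = divides (u / N ∸ v / N) (begin
  u ∸ v                                      ≡⟨ cong₂ _∸_ (m≡m%n+[m/n]*n u N) (m≡m%n+[m/n]*n v N) ⟩
  (u % N + u / N * N) ∸ (v % N + v / N * N)  ≡⟨ cong (λ r → (r + u / N * N) ∸ (v % N + v / N * N)) u≡v ⟩
  (v % N + u / N * N) ∸ (v % N + v / N * N)  ≡⟨ [m+n]∸[m+o]≡n∸o (v % N) _ _ ⟩
  u / N * N ∸ v / N * N                      ≡⟨ *-distribʳ-∸ N (u / N) (v / N) ⟨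
  (u / N ∸ v / N) * N                        ∎)
  where open ≡-Reasoning

∣∸⇒%≡% : ∀ N .{{_ : NonZero N}} {u v} → v ≤ u → N ∣ u ∸ v → u % N ≡ v % N
∣∸⇒%≡% N {u} {v} v≤u N∣u∸v = trans (cong (_% N) (sym (m∸n+n≡m v≤u))) (%-remove-+ˡ v N∣u∸v)

%≡%-reduce : ∀ d N .{{_ : NonZero d}} .{{_ : NonZero N}} → d ∣ N → ∀ {u v} → u % N ≡ v % N → u % d ≡ v % d
%≡%-reduce d N d∣N {u} {v} u≡v =
  trans (sym (m∣n⇒o%n%m≡o%m d N u d∣N)) (trans (cong (_% d) u≡v) (m∣n⇒o%n%m≡o%m d N v d∣N))

module _ (d e N : ℕ) .{{_ : NonZero d}} .{{_ : NonZero e}} .{{_ : NonZero N}}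
         (glue : ∀ {x} → d ∣ x → e ∣ x → N ∣ x) where

  %≡%-combine : ∀ {u v} → u % d ≡ v % d → u % e ≡ v % e → u % N ≡ v % N
  %≡%-combine {u} {v} u≡v[d] u≡v[e] with ≤-total v u
  ... | inj₁ v≤u = ∣∸⇒%≡% N v≤u (glue (%≡%⇒∣∸ d v≤u u≡v[d]) (%≡%⇒∣∸ e v≤u u≡v[e]))
  ... | inj₂ u≤v =
    sym (∣∸⇒%≡% N u≤v (glue (%≡%⇒∣∸ d u≤v (sym u≡v[d])) (%≡%⇒∣∸ e u≤v (sym u≡v[e]))))

  residues-injective : ∀ {m m′} → m < N → m′ < N → m % d ≡ m′ % d → m % e ≡ m′ % e → m ≡ m′
  residues-injective m<N m′<N m≡m′[d] m≡m′[e] =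
    trans (sym (m<n⇒m%n≡m m<N)) (trans (%≡%-combine m≡m′[d] m≡m′[e]) (m<n⇒m%n≡m m′<N))

∣∧<⇒≡0 : ∀ {N m} .{{_ : NonZero N}} → N ∣ m → m < N → m ≡ 0
∣∧<⇒≡0 {N} {m} N∣m m<N = trans (sym (m<n⇒m%n≡m m<N)) (n∣m⇒m%n≡0 m N N∣m)

m²≡m⇒∣m[m∸1] : ∀ N .{{_ : NonZero N}} {m} → (m * m) % N ≡ m % N → N ∣ m * (m ∸ 1)
m²≡m⇒∣m[m∸1] N {zero}   _    = N ∣0
m²≡m⇒∣m[m∸1] N {suc m′} m²≡m = subst (N ∣_) m²∸m≡mm′ (%≡%⇒∣∸ N (m≤m*n (suc m′) (suc m′)) m²≡m)
  where
  m²∸m≡mm′ : suc m′ * suc m′ ∸ suc m′ ≡ suc m′ * m′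
  m²∸m≡mm′ = trans (cong (suc m′ * suc m′ ∸_) (sym (*-identityʳ (suc m′))))
                   (sym (*-distribˡ-∸ (suc m′) (suc m′) 1))

%≡0%⇔∣ : ∀ N .{{_ : NonZero N}} {x} → x % N ≡ 0 % N ⇔ N ∣ x
%≡0%⇔∣ N {x} = mk⇔ (λ x≡0 → m%n≡0⇒n∣m x N (trans x≡0 0%N≡0))
                   (λ N∣x → trans (n∣m⇒m%n≡0 x N N∣x) (sym 0%N≡0))
  where
  0%N≡0 : 0 % N ≡ 0
  0%N≡0 = n∣m⇒m%n≡0 0 N (N ∣0)

#multiples : ∀ D E .{{_ : NonZero D}} → ∑[ m < D * E ] 𝟙 (D ∣? m) ≡ E
#multiples D zero    rewrite *-zeroʳ D = refl
#multiples D (suc E) = begin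
  ∑[ m < D * suc E ] 𝟙 (D ∣? m)
    ≡⟨ cong (λ N → ∑[ m < N ] 𝟙 (D ∣? m)) (trans (*-suc D E) (+-comm D (D * E))) ⟩
  ∑[ m < D * E + D ] 𝟙 (D ∣? m)
    ≡⟨ ∑-split (D * E) D (λ m → 𝟙 (D ∣? m)) ⟩
  ∑[ m < D * E ] 𝟙 (D ∣? m) + ∑[ j < D ] 𝟙 (D ∣? D * E + j)
    ≡⟨ cong₂ _+_ (#multiples D E) last-block ⟩
  E + 1
    ≡⟨ +-comm E 1 ⟩
  suc E
    ∎
  where
  open ≡-Reasoning
  last-block : ∑[ j < D ] 𝟙 (D ∣? D * E + j) ≡ 1
  last-block = trans (∑-cong D λ j j<D → 𝟙-cong _ (j ≟ 0) (mk⇔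
                       (λ D∣DE+j → ∣∧<⇒≡0 (∣m+n∣m⇒∣n D∣DE+j (m∣m*n E)) j<D)
                       (λ { refl → ∣m∣n⇒∣m+n (m∣m*n E) (D ∣0) })))
                     (∑-δ≡1 D 0 (n≢0⇒n>0 (≢-nonZero⁻¹ D)))

n/2≡⌊n/2⌋ : ∀ n → n / 2 ≡ ⌊ n /2⌋
n/2≡⌊n/2⌋ 0             = refl
n/2≡⌊n/2⌋ 1             = refl
n/2≡⌊n/2⌋ (suc (suc n)) = trans (m/n≡1+[m∸n]/n {suc (suc n)} {2} (s≤s (s≤s z≤n))) (cong suc (n/2≡⌊n/2⌋ n))

ModCompatible : (ℕ → ℕ) → Set
ModCompatible F = ∀ m k .{{_ : NonZero k}} → F m % k ≡ F (m % k) % k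

modCompatible-id : ModCompatible (λ m → m)
modCompatible-id m k = sym (m%n%n≡m%n m k)

modCompatible-const : ∀ c → ModCompatible (λ _ → c)
modCompatible-const c m k = refl

modCompatible-+ : ∀ {F G} → ModCompatible F → ModCompatible G → ModCompatible (λ m → F m + G m)
modCompatible-+ {F} {G} F-compat G-compat m k = begin
  (F m + G m) % k                          ≡⟨ %-distribˡ-+ (F m) (G m) k ⟩
  (F m % k + G m % k) % k                  ≡⟨ cong₂ (λ a b → (a + b) % k) (F-compat m k) (G-compat m k) ⟩
  (F (m % k) % k + G (m % k) % k) % k      ≡⟨ %-distribˡ-+ (F (m % k)) (G (m % k)) k ⟨
  (F (m % k) + G (m % k)) % k              ∎
  where open ≡-Reasoning

modCompatible-* : ∀ {F G} → ModCompatible F → ModCompatible G → ModCompatible (λ m → F m * G m)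
modCompatible-* {F} {G} F-compat G-compat m k = begin
  (F m * G m) % k                          ≡⟨ %-distribˡ-* (F m) (G m) k ⟩
  (F m % k * (G m % k)) % k                ≡⟨ cong₂ (λ a b → (a * b) % k) (F-compat m k) (G-compat m k) ⟩
  (F (m % k) % k * (G (m % k) % k)) % k    ≡⟨ %-distribˡ-* (F (m % k)) (G (m % k)) k ⟨
  (F (m % k) * G (m % k)) % k              ∎
  where open ≡-Reasoning

modCompatible-m²+cm : ∀ c → ModCompatible (λ m → m * m + c * m)
modCompatible-m²+cm c = modCompatible-+ (modCompatible-* modCompatible-id modCompatible-id)
                                        (modCompatible-* (modCompatible-const c) modCompatible-id)

#solutions : (F G : ℕ → ℕ) (N : ℕ) .{{_ : NonZero N}} → ℕ
#solutions F G N = ∑[ m < N ] 𝟙 (F m % N ≟ G m % N)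

#solutions-* : ∀ {F G} → ModCompatible F → ModCompatible G
             → ∀ d e N .{{_ : NonZero d}} .{{_ : NonZero e}} .{{_ : NonZero N}}
             → N ≡ d * e → (∀ {x} → d ∣ x → e ∣ x → N ∣ x)
             → #solutions F G N ≡ #solutions F G d * #solutions F G e
#solutions-* {F} {G} F-compat G-compat d e N N≡d*e glue = begin
  ∑[ m < N ] 𝟙 (F m % N ≟ G m % N)
    ≡⟨ ∑-cong N (λ m _ → trans (𝟙-cong _ _ (solution⇔local m)) (𝟙-× (local? d (m % d)) (local? e (m % e)))) ⟩
  ∑[ m < N ] (𝟙 (local? d (m % d)) * 𝟙 (local? e (m % e)))
    ≡⟨ ∑-CRT d e N N≡d*e (residues-injective d e N glue) (λ r → 𝟙 (local? d r)) (λ r → 𝟙 (local? e r)) ⟩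
  #solutions F G d * #solutions F G e
    ∎
  where
  open ≡-Reasoning
  local? : ∀ k .{{_ : NonZero k}} r → Dec (F r % k ≡ G r % k)
  local? k r = F r % k ≟ G r % k
  reduce : ∀ k .{{_ : NonZero k}} m → F m % k ≡ G m % k ⇔ F (m % k) % k ≡ G (m % k) % k
  reduce k m = mk⇔ (λ eq → trans (sym (F-compat m k)) (trans eq (G-compat m k)))
                   (λ eq → trans (F-compat m k) (trans eq (sym (G-compat m k))))
  solution⇔local : ∀ m → F m % N ≡ G m % N ⇔ (F (m % d) % d ≡ G (m % d) % d × F (m % e) % e ≡ G (m % e) % e)
  solution⇔local m = mk⇔
    (λ eq → Equivalence.to (reduce d m) (%≡%-reduce d N (divides e (trans N≡d*e (*-comm d e))) eq)
          , Equivalence.to (reduce e m) (%≡%-reduce e N (divides d N≡d*e) eq))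
    (λ { (eq[d] , eq[e]) → %≡%-combine d e N glue
          (Equivalence.from (reduce d m) eq[d]) (Equivalence.from (reduce e m) eq[e]) })

^-monoʳ-∣ : ∀ p {a b} → a ≤ b → p ^ a ∣ p ^ b
^-monoʳ-∣ p {a} {b} a≤b = divides (p ^ (b ∸ a)) (begin
  p ^ b              ≡⟨ cong (p ^_) (m∸n+n≡m a≤b) ⟨
  p ^ (b ∸ a + a)    ≡⟨ ^-distribˡ-+-* p (b ∸ a) a ⟩
  p ^ (b ∸ a) * p ^ a ∎)
  where open ≡-Reasoning

module _ {p : ℕ} (p-prime : Prime p) where

  private instance
    p≢0 : NonZero p
    p≢0 = prime⇒nonZero p-prime

  prime∤1 : ¬ p ∣ 1
  prime∤1 p∣1 = nonTrivial⇒≢1 {{prime⇒nonTrivial p-prime}} (∣1⇒≡1 p∣1)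

  prime∣^⇒∣ : ∀ {m} k → p ∣ m ^ k → p ∣ m
  prime∣^⇒∣ zero    p∣1 = contradiction p∣1 prime∤1
  prime∣^⇒∣ {m} (suc k) p∣m^[1+k] with euclidsLemma m (m ^ k) p-prime p∣m^[1+k]
  ... | inj₁ p∣m   = p∣m
  ... | inj₂ p∣m^k = prime∣^⇒∣ k p∣m^k

  prime^∣*⇒∣ : ∀ k {a b} → p ^ k ∣ a * b → ¬ p ∣ a → p ^ k ∣ b
  prime^∣*⇒∣ zero    {b = b} _ _ = 1∣ b
  prime^∣*⇒∣ (suc k) {a} {b} p^[1+k]∣ab p∤a with euclidsLemma a b p-prime (∣-trans (m∣m*n (p ^ k)) p^[1+k]∣ab)
  ... | inj₁ p∣a = contradiction p∣a p∤a
  ... | inj₂ (divides b′ refl) =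
    subst (p * p ^ k ∣_) (*-comm p b′) (*-monoʳ-∣ p (prime^∣*⇒∣ k p^k∣ab′ p∤a))
    where
    p^k∣ab′ : p ^ k ∣ a * b′
    p^k∣ab′ = *-cancelˡ-∣ p (subst (p * p ^ k ∣_) (regroup a b′ p) p^[1+k]∣ab)
      where
      regroup : ∀ a b p → a * (b * p) ≡ p * (a * b)
      regroup = solve-∀

  prime^∣∧∣⇒*∣ : ∀ k {R x} → ¬ p ∣ R → p ^ k ∣ x → R ∣ x → p ^ k * R ∣ x
  prime^∣∧∣⇒*∣ k {R} p∤R p^k∣x (divides t refl) =
    *-monoˡ-∣ R (prime^∣*⇒∣ k (subst (p ^ k ∣_) (*-comm t R) p^k∣x) p∤R)

  prime^∣m[m∸1]⇒m≤1 : ∀ k {m} → m < p ^ k → p ^ k ∣ m * (m ∸ 1) → m ≤ 1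
  prime^∣m[m∸1]⇒m≤1 k {zero}    _       _ = z≤n
  prime^∣m[m∸1]⇒m≤1 k {suc m′} m<p^k p^k∣mm′ with p ∣? suc m′
  ... | yes p∣m = contradiction (∣⇒≤ (prime^∣*⇒∣ k p^k∣m′m p∤m′)) (<⇒≱ m<p^k)
    where
    p∤m′ : ¬ p ∣ m′
    p∤m′ p∣m′ = prime∤1 (∣m+n∣m⇒∣n (subst (p ∣_) (+-comm 1 m′) p∣m) p∣m′)
    p^k∣m′m : p ^ k ∣ m′ * suc m′
    p^k∣m′m = subst (p ^ k ∣_) (*-comm (suc m′) m′) p^k∣mm′
  ... | no p∤m =
    s≤s (≤-reflexive (∣∧<⇒≡0 {{m^n≢0 p k}} (prime^∣*⇒∣ k p^k∣mm′ p∤m) (<-trans (n<1+n m′) m<p^k)))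

  1<prime^ : ∀ {k} → 1 ≤ k → 1 < p ^ k
  1<prime^ {k} k≥1 = ≤-trans (nonTrivial⇒n>1 p {{prime⇒nonTrivial p-prime}})
                             (subst (_≤ p ^ k) (*-identityʳ p) (^-monoʳ-≤ p k≥1))

  #solutions-idempotent : ∀ k .{{_ : NonZero (p ^ k)}} → 1 ≤ k → #solutions (λ m → m * m) (λ m → m) (p ^ k) ≡ 2
  #solutions-idempotent k k≥1 = begin
    ∑[ m < p ^ k ] 𝟙 ((m * m) % p ^ k ≟ m % p ^ k)  ≡⟨ ∑-cong (p ^ k) indicator≡δ0+δ1 ⟩
    ∑[ m < p ^ k ] (δ m 0 + δ m 1)                 ≡⟨ ∑-distrib-+ (p ^ k) (λ m → δ m 0) (λ m → δ m 1) ⟩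
    ∑[ m < p ^ k ] δ m 0 + ∑[ m < p ^ k ] δ m 1     ≡⟨ cong₂ _+_ (∑-δ≡1 (p ^ k) 0 (<-trans z<s (1<prime^ k≥1)))
                                                                 (∑-δ≡1 (p ^ k) 1 (1<prime^ k≥1)) ⟩
    2                                              ∎
    where
    open ≡-Reasoning
    indicator≡δ0+δ1 : ∀ m → m < p ^ k → 𝟙 ((m * m) % p ^ k ≟ m % p ^ k) ≡ δ m 0 + δ m 1
    indicator≡δ0+δ1 0             _     = 𝟙-yes (0 % p ^ k ≟ 0 % p ^ k) refl
    indicator≡δ0+δ1 1             _     = 𝟙-yes (1 % p ^ k ≟ 1 % p ^ k) refl
    indicator≡δ0+δ1 (suc (suc m)) m<p^k = 𝟙-no ((suc (suc m) * suc (suc m)) % p ^ k ≟ suc (suc m) % p ^ k)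
      λ m²≡m → contradiction (prime^∣m[m∸1]⇒m≤1 k m<p^k (m²≡m⇒∣m[m∸1] (p ^ k) m²≡m)) λ { (s≤s ()) }

  prime∣m²+cm⇔prime∣m : ∀ {c m} → p ∣ c → p ∣ m * m + c * m ⇔ p ∣ m
  prime∣m²+cm⇔prime∣m {c} {m} p∣c = mk⇔
    (λ p∣m²+cm → [ id , id ]′ (euclidsLemma m m p-prime
      (∣m+n∣m⇒∣n (subst (p ∣_) (+-comm (m * m) (c * m)) p∣m²+cm) (∣m⇒∣m*n m p∣c))))
    (λ p∣m → ∣m∣n⇒∣m+n (∣m⇒∣m*n m p∣m) (∣n⇒∣m*n c p∣m))

  -- For k ≥ 2 both sides force p ∣ m; dividing m and c by p lowers k by 2.
  prime^k∣m²+cm⇔prime^⌈k/2⌉∣m : ∀ k {c m} → p ^ ⌈ k /2⌉ ∣ c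
                              → p ^ k ∣ m * m + c * m ⇔ p ^ ⌈ k /2⌉ ∣ m
  prime^k∣m²+cm⇔prime^⌈k/2⌉∣m zero {m = m} _ = mk⇔ (λ _ → 1∣ m) (λ _ → 1∣ _)
  prime^k∣m²+cm⇔prime^⌈k/2⌉∣m 1 {c} {m} p^1∣c = begin
    p * 1 ∣ m * m + c * m  ≡⟨ cong (_∣ m * m + c * m) (*-identityʳ p) ⟩
    p ∣ m * m + c * m      ∼⟨ prime∣m²+cm⇔prime∣m (subst (_∣ c) (*-identityʳ p) p^1∣c) ⟩
    p ∣ m                  ≡⟨ cong (_∣ m) (*-identityʳ p) ⟨
    p * 1 ∣ m              ∎
    where open EquationalReasoning {k = equivalence}
  prime^k∣m²+cm⇔prime^⌈k/2⌉∣m (suc (suc k)) {c} {m} p^⌈k/2⌉+1∣c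
    with ∣-trans (m∣m*n {p} (p ^ ⌈ k /2⌉)) p^⌈k/2⌉+1∣c | p ∣? m
  ... | divides c′ refl | no p∤m = mk⇔
    (λ p^[2+k]∣m²+cm → contradiction
       (Equivalence.to (prime∣m²+cm⇔prime∣m (n∣m*n c′)) (∣-trans (m∣m*n (p * p ^ k)) p^[2+k]∣m²+cm)) p∤m)
    (λ p^⌈k/2⌉+1∣m → contradiction (∣-trans (m∣m*n (p ^ ⌈ k /2⌉)) p^⌈k/2⌉+1∣m) p∤m)
  ... | divides c′ refl | yes (divides m′ refl) = begin
    p * (p * p ^ k) ∣ m′ * p * (m′ * p) + c′ * p * (m′ * p)  ≡⟨ cong (p * (p * p ^ k) ∣_) (factor-p² m′ c′ p) ⟩
    p * (p * p ^ k) ∣ p * (p * (m′ * m′ + c′ * m′))          ∼⟨ ⇔.trans cancel cancel ⟩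
    p ^ k ∣ m′ * m′ + c′ * m′                                ∼⟨ prime^k∣m²+cm⇔prime^⌈k/2⌉∣m k p^⌈k/2⌉∣c′ ⟩
    p ^ ⌈ k /2⌉ ∣ m′                                          ∼⟨ ⇔.sym cancel ⟩
    p * p ^ ⌈ k /2⌉ ∣ p * m′                                  ≡⟨ cong (p * p ^ ⌈ k /2⌉ ∣_) (*-comm p m′) ⟩
    p * p ^ ⌈ k /2⌉ ∣ m′ * p                                  ∎
    where
    open EquationalReasoning {k = equivalence}
    cancel : ∀ {a b} → p * a ∣ p * b ⇔ a ∣ b
    cancel = mk⇔ (*-cancelˡ-∣ p) (*-monoʳ-∣ p)
    p^⌈k/2⌉∣c′ : p ^ ⌈ k /2⌉ ∣ c′
    p^⌈k/2⌉∣c′ = Equivalence.to cancel (subst (p * p ^ ⌈ k /2⌉ ∣_) (*-comm c′ p) p^⌈k/2⌉+1∣c)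
    factor-p² : ∀ m c p → m * p * (m * p) + c * p * (m * p) ≡ p * (p * (m * m + c * m))
    factor-p² = solve-∀

  #solutions-m²+cm : ∀ k c .{{_ : NonZero (p ^ k)}} → p ^ ⌈ k /2⌉ ∣ c
                   → #solutions (λ m → m * m + c * m) (λ _ → 0) (p ^ k) ≡ p ^ (k / 2)
  #solutions-m²+cm k c p^⌈k/2⌉∣c = begin
    ∑[ m < p ^ k ] 𝟙 ((m * m + c * m) % p ^ k ≟ 0 % p ^ k)
      ≡⟨ ∑-cong (p ^ k) (λ m _ → 𝟙-cong _ (p ^ ⌈ k /2⌉ ∣? m)
           (⇔.trans (%≡0%⇔∣ (p ^ k)) (prime^k∣m²+cm⇔prime^⌈k/2⌉∣m k p^⌈k/2⌉∣c))) ⟩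
    ∑[ m < p ^ k ] 𝟙 (p ^ ⌈ k /2⌉ ∣? m)
      ≡⟨ cong (λ N → ∑[ m < N ] 𝟙 (p ^ ⌈ k /2⌉ ∣? m)) p^k≡p^⌈k/2⌉*p^⌊k/2⌋ ⟩
    ∑[ m < p ^ ⌈ k /2⌉ * p ^ ⌊ k /2⌋ ] 𝟙 (p ^ ⌈ k /2⌉ ∣? m)
      ≡⟨ #multiples (p ^ ⌈ k /2⌉) (p ^ ⌊ k /2⌋) ⟩
    p ^ ⌊ k /2⌋
      ≡⟨ cong (p ^_) (n/2≡⌊n/2⌋ k) ⟨
    p ^ (k / 2)
      ∎
    where
    open ≡-Reasoning
    instance
      p^⌈k/2⌉≢0 : NonZero (p ^ ⌈ k /2⌉)
      p^⌈k/2⌉≢0 = m^n≢0 p ⌈ k /2⌉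
    p^k≡p^⌈k/2⌉*p^⌊k/2⌋ : p ^ k ≡ p ^ ⌈ k /2⌉ * p ^ ⌊ k /2⌋
    p^k≡p^⌈k/2⌉*p^⌊k/2⌋ = trans (cong (p ^_) (trans (sym (⌊n/2⌋+⌈n/2⌉≡n k)) (+-comm ⌊ k /2⌋ ⌈ k /2⌉)))
                                (^-distribˡ-+-* p ⌈ k /2⌉ ⌊ k /2⌋)

¬2∣⇒%2≡1 : ∀ {c} → ¬ 2 ∣ c → c % 2 ≡ 1
¬2∣⇒%2≡1 {c} 2∤c with c % 2 in c%2≡r | m%n<n c 2
... | 0 | _           = contradiction (m%n≡0⇒n∣m c 2 c%2≡r) 2∤c
... | 1 | _           = refl
... | suc (suc _) | s≤s (s≤s ())

#solutions-m²+cm-mod2 : ∀ c → ¬ 2 ∣ c → #solutions (λ m → m * m + c * m) (λ _ → 0) 2 ≡ 2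
#solutions-m²+cm-mod2 c 2∤c = cong₂ _+_
  (𝟙-yes ((0 * 0 + c * 0) % 2 ≟ 0) (cong (_% 2) (*-zeroʳ c)))
  (𝟙-yes ((1 * 1 + c * 1) % 2 ≟ 0) (begin
    (1 + c * 1) % 2      ≡⟨ cong (λ x → (1 + x) % 2) (*-identityʳ c) ⟩
    (1 + c) % 2          ≡⟨ %-distribˡ-+ 1 c 2 ⟩
    (1 + c % 2) % 2      ≡⟨ cong (λ r → (1 + r) % 2) (¬2∣⇒%2≡1 2∤c) ⟩
    0                    ∎))
  where open ≡-Reasoning

∏ : List (ℕ × ℕ) → ℕ
∏ fs = product (map (λ pk → proj₁ pk ^ proj₂ pk) fs)

PrimeExponentPairs : List (ℕ × ℕ) → Set
PrimeExponentPairs = All (λ pk → Prime (proj₁ pk) × 1 ≤ proj₂ pk)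

∏-nonZero : ∀ {fs} → PrimeExponentPairs fs → NonZero (∏ fs)
∏-nonZero []                          = _
∏-nonZero {(p , k) ∷ _} ((p-prime , _) ∷ pairs) =
  m*n≢0 (p ^ k) _ {{m^n≢0 p k {{prime⇒nonZero p-prime}}}} {{∏-nonZero pairs}}

prime∤∏ : ∀ {p fs} → Prime p → PrimeExponentPairs fs → All (λ pk → p ≢ proj₁ pk) fs → ¬ p ∣ ∏ fs
prime∤∏ p-prime [] [] = prime∤1 p-prime
prime∤∏ {p} {(q , j) ∷ fs} p-prime ((q-prime , _) ∷ pairs) (p≢q ∷ p≢fs) p∣∏
  with euclidsLemma (q ^ j) (∏ fs) p-prime p∣∏
... | inj₂ p∣∏fs = prime∤∏ p-prime pairs p≢fs p∣∏fs
... | inj₁ p∣q^j with prime⇒irreducible q-prime (prime∣^⇒∣ p-prime j p∣q^j)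
...   | inj₁ p≡1 = nonTrivial⇒≢1 {{prime⇒nonTrivial p-prime}} p≡1
...   | inj₂ p≡q = p≢q p≡q

HasLocalCount : (F G : ℕ → ℕ) → (ℕ × ℕ → ℕ) → ℕ × ℕ → Set
HasLocalCount F G v pk = ∀ .{{_ : NonZero (proj₁ pk ^ proj₂ pk)}} → #solutions F G (proj₁ pk ^ proj₂ pk) ≡ v pk

#solutions-1 : ∀ F G → #solutions F G 1 ≡ 1
#solutions-1 F G = 𝟙-yes (F 0 % 1 ≟ G 0 % 1) (trans (n%1≡0 (F 0)) (sym (n%1≡0 (G 0))))

#solutions-∏ : ∀ {F G} → ModCompatible F → ModCompatible G → (v : ℕ × ℕ → ℕ)
             → ∀ N .{{_ : NonZero N}} fs → IsPrimeFactorization N fs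
             → All (HasLocalCount F G v) fs
             → #solutions F G N ≡ product (map v fs)
#solutions-∏ {F} {G} _ _ v _ [] (_ , _ , refl) [] = #solutions-1 F G
#solutions-∏ F-compat G-compat v _ ((p , k) ∷ fs)
             ((p-prime , _) ∷ pairs , p∉fs ∷ unique , refl) (local ∷ locals) =
  trans (#solutions-* F-compat G-compat (p ^ k) (∏ fs) _ refl
           (prime^∣∧∣⇒*∣ p-prime k (prime∤∏ p-prime pairs (All.map⁻ p∉fs))))
        (cong₂ _*_ local (#solutions-∏ F-compat G-compat v (∏ fs) fs (pairs , unique , refl) locals))
  where
  instance
    p^k≢0 : NonZero (p ^ k)
    p^k≢0 = m^n≢0 p k {{prime⇒nonZero p-prime}}
    ∏≢0 : NonZero (∏ fs)
    ∏≢0 = ∏-nonZero pairs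

half-powers-divide : ∀ {fs x} → ∏ fs ∣ x → All (λ pk → proj₁ pk ^ ⌈ proj₂ pk /2⌉ ∣ x) fs
half-powers-divide {[]}           _    = []
half-powers-divide {(p , k) ∷ fs} ∏∣x =
    ∣-trans (^-monoʳ-∣ p (⌈n/2⌉≤n k)) (∣-trans (m∣m*n (∏ fs)) ∏∣x)
  ∷ half-powers-divide (∣-trans (n∣m*n (p ^ k)) ∏∣x)

#solutions-idempotent-∏ : ∀ N .{{_ : NonZero N}} fs → IsPrimeFactorization N fs
                        → #solutions (λ m → m * m) (λ m → m) N ≡ 2 ^ length fs
#solutions-idempotent-∏ N fs factorization@(pairs , _) =
  trans (#solutions-∏ (modCompatible-* modCompatible-id modCompatible-id) modCompatible-id
                      (λ _ → 2) N fs factorization (locals pairs))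
        (product-2s fs)
  where
  locals : ∀ {fs} → PrimeExponentPairs fs
         → All (HasLocalCount (λ m → m * m) (λ m → m) (λ _ → 2)) fs
  locals [] = []
  locals {(_ , k) ∷ _} ((p-prime , k≥1) ∷ pairs) = #solutions-idempotent p-prime k k≥1 ∷ locals pairs
  product-2s : ∀ fs → product (map (λ _ → 2) fs) ≡ 2 ^ length fs
  product-2s []       = refl
  product-2s (_ ∷ fs) = cong (2 *_) (product-2s fs)

#solutions-m²+cm-∏ : ∀ c N .{{_ : NonZero N}} fs → IsPrimeFactorization N fs
                   → All (λ pk → proj₁ pk ^ ⌈ proj₂ pk /2⌉ ∣ c) fs
                   → #solutions (λ m → m * m + c * m) (λ _ → 0) N ≡ halfPowProduct fs
#solutions-m²+cm-∏ c N fs factorization@(pairs , _) p^⌈k/2⌉∣c =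
  #solutions-∏ (modCompatible-m²+cm c) (modCompatible-const 0) (λ pk → proj₁ pk ^ (proj₂ pk / 2)) N fs factorization
               (locals pairs p^⌈k/2⌉∣c)
  where
  locals : ∀ {fs} → PrimeExponentPairs fs → All (λ pk → proj₁ pk ^ ⌈ proj₂ pk /2⌉ ∣ c) fs
         → All (HasLocalCount (λ m → m * m + c * m) (λ _ → 0) (λ pk → proj₁ pk ^ (proj₂ pk / 2))) fs
  locals [] [] = []
  locals {(_ , k) ∷ _} ((p-prime , _) ∷ pairs) (p^⌈k/2⌉∣c ∷ rest) =
    #solutions-m²+cm p-prime k c p^⌈k/2⌉∣c ∷ locals pairs rest

#solutions-m² : ∀ N .{{_ : NonZero N}} fs → IsPrimeFactorization N fs
              → #solutions (λ m → m * m) (λ _ → 0) N ≡ halfPowProduct fs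
#solutions-m² N fs factorization =
  trans (∑-cong N λ m _ → 𝟙-cong _ _ (mk⇔ (trans (cong (_% N) (+-identityʳ (m * m))))
                                         (trans (cong (_% N) (sym (+-identityʳ (m * m)))))))
        (#solutions-m²+cm-∏ 0 N fs factorization (half-powers-divide (∏ fs ∣0)))

/2-exact : ∀ {N M} → N ≡ 2 * M → N / 2 ≡ M
/2-exact {M = M} refl = trans (cong (_/ 2) (*-comm 2 M)) (m*n/n≡m M 2)

#solutions-m²+[N/2]m-4∣N : ∀ N .{{_ : NonZero N}} fs k₁ rest → fs ≡ (2 , k₁) ∷ rest → IsPrimeFactorization N fs
                         → 4 ∣ N → #solutions (λ m → m * m + (N / 2) * m) (λ _ → 0) N ≡ halfPowProduct fs
#solutions-m²+[N/2]m-4∣N _ _ 0 _ refl (((_ , ()) ∷ _) , _) _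
#solutions-m²+[N/2]m-4∣N _ _ 1 _ refl ((_ ∷ pairs) , 2∉rest ∷ _ , N≡) 4∣N =
  contradiction (*-cancelˡ-∣ 2 (subst (4 ∣_) (sym N≡) 4∣N)) (prime∤∏ prime[2] pairs (All.map⁻ 2∉rest))
#solutions-m²+[N/2]m-4∣N N fs (suc (suc j)) rest refl factorization@(_ , _ , N≡) _ =
  #solutions-m²+cm-∏ (N / 2) N fs factorization (2^⌈k₁/2⌉∣N/2 ∷ half-powers-divide ∏rest∣N/2)
  where
  N/2≡ : N / 2 ≡ 2 ^ suc j * ∏ rest
  N/2≡ = /2-exact (trans (sym N≡) (*-assoc 2 (2 ^ suc j) (∏ rest)))
  2^⌈k₁/2⌉∣N/2 : 2 ^ ⌈ suc (suc j) /2⌉ ∣ N / 2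
  2^⌈k₁/2⌉∣N/2 = subst (2 ^ ⌈ suc (suc j) /2⌉ ∣_) (sym N/2≡)
                       (∣m⇒∣m*n (∏ rest) (^-monoʳ-∣ 2 (s≤s (⌈n/2⌉≤n j))))
  ∏rest∣N/2 : ∏ rest ∣ N / 2
  ∏rest∣N/2 = subst (∏ rest ∣_) (sym N/2≡) (n∣m*n (2 ^ suc j))

#solutions-m²+[N/2]m-4∤N : ∀ N .{{_ : NonZero N}} fs k₁ rest → fs ≡ (2 , k₁) ∷ rest → IsPrimeFactorization N fs
                         → ¬ 4 ∣ N → #solutions (λ m → m * m + (N / 2) * m) (λ _ → 0) N ≡ 2 * halfPowProduct rest
#solutions-m²+[N/2]m-4∤N _ _ 0 _ refl (((_ , ()) ∷ _) , _) _
#solutions-m²+[N/2]m-4∤N _ _ (suc (suc j)) rest refl (_ , _ , N≡) 4∤N =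
  contradiction (divides (2 ^ j * ∏ rest) (trans (sym N≡) (regroup (2 ^ j) (∏ rest)))) 4∤N
  where
  regroup : ∀ a b → 2 * (2 * a) * b ≡ a * b * 4
  regroup = solve-∀
#solutions-m²+[N/2]m-4∤N N _ 1 rest refl ((_ ∷ pairs) , 2∉rest ∷ unique , N≡) _ = begin
  #solutions F (λ _ → 0) N
    ≡⟨ #solutions-* (modCompatible-m²+cm (N / 2)) (modCompatible-const 0) 2 (∏ rest) N (sym N≡) glue ⟩
  #solutions F (λ _ → 0) 2 * #solutions F (λ _ → 0) (∏ rest)
    ≡⟨ cong₂ _*_ (#solutions-m²+cm-mod2 (N / 2) 2∤N/2)
                 (#solutions-m²+cm-∏ (N / 2) (∏ rest) rest (pairs , unique , refl)
                                     (half-powers-divide (∣-reflexive (sym N/2≡∏rest)))) ⟩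
  2 * halfPowProduct rest
    ∎
  where
  open ≡-Reasoning
  F : ℕ → ℕ
  F m = m * m + (N / 2) * m
  instance
    ∏rest≢0 : NonZero (∏ rest)
    ∏rest≢0 = ∏-nonZero pairs
  2∤∏rest : ¬ 2 ∣ ∏ rest
  2∤∏rest = prime∤∏ prime[2] pairs (All.map⁻ 2∉rest)
  N/2≡∏rest : N / 2 ≡ ∏ rest
  N/2≡∏rest = /2-exact (sym N≡)
  2∤N/2 : ¬ 2 ∣ N / 2
  2∤N/2 = subst (λ c → ¬ 2 ∣ c) (sym N/2≡∏rest) 2∤∏rest
  glue : ∀ {x} → 2 ∣ x → ∏ rest ∣ x → N ∣ x
  glue 2∣x ∏∣x = subst (_∣ _) N≡ (prime^∣∧∣⇒*∣ prime[2] 1 2∤∏rest 2∣x ∏∣x)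

lemma3p3 : (q : ℕ) → IsPrimePower q → (fs : List (ℕ × ℕ)) → IsPrimeFactorization (q + 1) fs
    → (q % 2 ≡ 1 → ∃[ k₁ ] ∃[ rest ] fs ≡ (2 , k₁) ∷ rest)
    → (countBelow (suc q) (λ m → ModEq (suc q) (m * m) m) (λ m → (m * m) % suc q ≟ m % suc q) ≡ 2 ^ length fs)
      × (q % 2 ≡ 0 → countBelow (suc q) (λ m → ModEq (suc q) (m * m) 0) (λ m → (m * m) % suc q ≟ 0 % suc q) ≡ halfPowProduct fs)
      × (q % 4 ≡ 3 → countBelow (suc q) (λ m → ModEq (suc q) (m * m + ((q + 1) / 2) * m) 0) (λ m → (m * m + ((q + 1) / 2) * m) % suc q ≟ 0 % suc q) ≡ halfPowProduct fs)
      × (q % 4 ≡ 1 → ∀ k₁ rest → fs ≡ (2 , k₁) ∷ rest → countBelow (suc q) (λ m → ModEq (suc q) (m * m + ((q + 1) / 2) * m) 0) (λ m → (m * m + ((q + 1) / 2) * m) % suc q ≟ 0 % suc q) ≡ 2 * halfPowProduct rest)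
lemma3p3 q _ fs factorization odd⇒2-first rewrite +-comm q 1 =
    trans (countBelow≡∑𝟙 (suc q) _) (#solutions-idempotent-∏ (suc q) fs factorization)
  , (λ _ → trans (countBelow≡∑𝟙 (suc q) _) (#solutions-m² (suc q) fs factorization))
  , (λ q%4≡3 → let k₁ , rest , fs≡ = odd⇒2-first (q%4≡3⇒q%2≡1 q%4≡3) in
       trans (countBelow≡∑𝟙 (suc q) _)
             (#solutions-m²+[N/2]m-4∣N (suc q) fs k₁ rest fs≡ factorization (q%4≡3⇒4∣1+q q%4≡3)))
  , (λ q%4≡1 k₁ rest fs≡ →
       trans (countBelow≡∑𝟙 (suc q) _)
             (#solutions-m²+[N/2]m-4∤N (suc q) fs k₁ rest fs≡ factorization (q%4≡1⇒4∤1+q q%4≡1)))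
  where
  [1+q]%4 : suc q % 4 ≡ suc (q % 4) % 4
  [1+q]%4 = %-distribˡ-+ 1 q 4
  q%4≡3⇒q%2≡1 : q % 4 ≡ 3 → q % 2 ≡ 1
  q%4≡3⇒q%2≡1 q%4≡3 = trans (sym (m∣n⇒o%n%m≡o%m 2 4 q (divides 2 refl))) (cong (_% 2) q%4≡3)
  q%4≡3⇒4∣1+q : q % 4 ≡ 3 → 4 ∣ suc q
  q%4≡3⇒4∣1+q q%4≡3 = m%n≡0⇒n∣m (suc q) 4 (trans [1+q]%4 (cong (λ r → suc r % 4) q%4≡3))
  q%4≡1⇒4∤1+q : q % 4 ≡ 1 → ¬ 4 ∣ suc q
  q%4≡1⇒4∤1+q q%4≡1 4∣1+q = contradiction
    (trans (cong (λ r → suc r % 4) (sym q%4≡1)) (trans (sym [1+q]%4) (n∣m⇒m%n≡0 (suc q) 4 4∣1+q)))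
    λ ()
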